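{- For a graph $G$ on $n$ vertices, $$m(G,2)\le t_2(G)\le b_2(G)\le m(G,2)+\tau(G,2).$$
   Context: All graphs are finite and connected. 2-neighbor bootstrap percolation: a set $A\subseteq V(G)$ is colored blue at round $0$, and at each round $t>0$ every vertex with at least two blue neighbors at round $t-1$ becomes blue; $A$ is a percolating set if eventually every vertex is blue. $m(G,2)$ is the minimum cardinality of a percolating set, and $\tau(G,2)$ is the minimum, over all percolating sets of cardinality $m(G,2)$, of the number of rounds until every vertex is blue. The 2-burning process: given a sequence $s=(s_1,\dots,s_k)$ of vertices (sources), at round $0$ all vertices are uncolored; at each round $j\ge1$, (i) if $j\le k$ and $s_j$ is uncolored, $s_j$ is colored blue, and (ii) every uncolored vertex having at least two neighbors that were blue at the end of round $j-1$ is colored blue. $s$ is a 2-burning sequence if eventually all vertices are blue; $\mathrm{len}(s)=k$ and $\mathrm{rd}(s)$ is the first round at the end of which all vertices are blue. $b_2(G)$ is the minimum of $\mathrm{rd}(s)$ over all 2-burning sequences; a 2-burning sequence achieving it is optimal; $t_2(G)$ is the minimum length of an optimal 2-burning sequence. -}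

module Defs where

open import Data.Nat using (ℕ; zero; suc; _+_; _≤_; _<_; _≤ᵇ_)
open import Data.Bool using (Bool; true; false; _∧_; _∨_; if_then_else_)
open import Data.Fin using (Fin; _≟_) renaming (zero to fzero; suc to fsuc)
open import Data.List using (List; []; _∷_; length)
open import Data.Product using (Σ; ∃; _×_; _,_)
open import Relation.Nullary.Decidable using (⌊_⌋)
open import Relation.Binary.PropositionalEquality using (_≡_)

record Graph : Set where
  field
    n     : ℕ
    Adj   : Fin n → Fin n → Bool
    sym   : ∀ u v → Adj u v ≡ Adj v u
    irrefl : ∀ v → Adj v v ≡ false

module _ (G : Graph) where
  open Graph G

  data Reach (u : Fin n) : Fin n → Set where
    here : Reach u u
    step : ∀ {v w} → Reach u v → Adj v w ≡ true → Reach u w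

  Connected : Set
  Connected = (0 < n) × (∀ u v → Reach u v)

  VSet : Set
  VSet = Fin n → Bool

  count : ∀ {k} → (Fin k → Bool) → ℕ
  count {zero}  f = 0
  count {suc k} f = (if f fzero then 1 else 0) + count (λ i → f (fsuc i))

  card : VSet → ℕ
  card = count

  nbrs : VSet → Fin n → ℕ
  nbrs B v = count (λ u → Adj v u ∧ B u)

  twoNbrs : VSet → Fin n → Bool
  twoNbrs B v = 2 ≤ᵇ nbrs B v

  AllBlue : VSet → Set
  AllBlue B = ∀ v → B v ≡ true

  blueAt : VSet → ℕ → VSet
  blueAt A zero    = A
  blueAt A (suc t) = λ v → blueAt A t v ∨ twoNbrs (blueAt A t) v

  Percolating : VSet → Set
  Percolating A = ∃ λ t → AllBlue (blueAt A t)

  PercRounds : VSet → ℕ → Set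
  PercRounds A r = AllBlue (blueAt A r) × (∀ s → AllBlue (blueAt A s) → r ≤ s)

  IsM2 : ℕ → Set
  IsM2 m = (Σ VSet λ A → Percolating A × card A ≡ m)
         × (∀ A → Percolating A → m ≤ card A)

  IsTau2 : ℕ → ℕ → Set
  IsTau2 m τ = (Σ VSet λ A → card A ≡ m × PercRounds A τ)
             × (∀ A r → card A ≡ m → PercRounds A r → τ ≤ r)

  -- srcAt s j v : v is the (j+1)-st source s_{j+1}
  srcAt : List (Fin n) → ℕ → Fin n → Bool
  srcAt []       j       v = false
  srcAt (x ∷ xs) zero    v = ⌊ x ≟ v ⌋
  srcAt (x ∷ xs) (suc j) v = srcAt xs j v

  -- blue set at the end of round j
  burnAt : List (Fin n) → ℕ → VSet
  burnAt s zero    = λ v → false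
  burnAt s (suc j) = λ v → burnAt s j v ∨ srcAt s j v ∨ twoNbrs (burnAt s j) v

  Rd : List (Fin n) → ℕ → Set
  Rd s r = AllBlue (burnAt s r) × (∀ r' → AllBlue (burnAt s r') → r ≤ r')

  IsB2 : ℕ → Set
  IsB2 b = (Σ (List (Fin n)) λ s → Rd s b) × (∀ s r → Rd s r → b ≤ r)

  IsT2 : ℕ → ℕ → Set
  IsT2 b t = (Σ (List (Fin n)) λ s → Rd s b × length s ≡ t)
           × (∀ s → Rd s b → t ≤ length s)

{-# OPTIONS --safe #-}
-- The sources of a 2-burning sequence form a percolating set, because burning
-- is dominated round by round by bootstrap percolation started from all of its
-- sources at once; this gives m ≤ t. Conversely, feeding the vertices of a minimum percolating set A one
-- per round and then letting percolation act burns everything within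
-- |A| + τ rounds, so b ≤ m + τ.
module Submission where

open import Defs
open import Algebra.Properties.CommutativeSemigroup using (interchange)
open import Data.Bool using (Bool; true; false; _∧_; _∨_; if_then_else_)
open import Data.Bool.Properties using (T-≡) renaming (_≟_ to _≟ᵇ_)
open import Data.Fin using (Fin; _≟_) renaming (zero to fzero; suc to fsuc)
open import Data.Fin.Properties using (all?)
open import Data.Bool.ListAction using (any)
open import Data.List using (List; []; _∷_; length; map; take)
open import Data.List.Membership.Propositional using (_∈_)
open import Data.List.Membership.Propositional.Properties using (∈-map⁺)
open import Data.List.Properties using (length-map; length-take)
open import Data.List.Relation.Unary.Any using (here; there)
open import Data.Nat
  using (ℕ; zero; suc; _+_; _≤_; _<_; _⊓_; _≤′_; _≤ᵇ_; z≤n; s≤s; ≤′-refl; ≤′-step)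
open import Data.Nat.Properties
  using (≤-refl; ≤-reflexive; ≤-trans; <⇒≤; ≤-total; ≤∧≢⇒<; 1+n≰n; ≤⇒≤′; ≤ᵇ⇒≤; ≤⇒≤ᵇ;
         +-mono-≤; +-comm; m⊓n≤m; +-commutativeSemigroup; module ≤-Reasoning)
open import Data.Product using (∃; _×_; _,_; proj₁; proj₂)
open import Data.Sum using (_⊎_; inj₁; inj₂)
open import Function using (_∘_)
open import Function.Bundles using (Equivalence)
open import Relation.Nullary using (Dec; yes; no; contradiction)
open import Relation.Nullary.Decidable using (⌊_⌋; ⌊⌋-map′; isYes≗does; dec-true)
open import Relation.Binary.PropositionalEquality using (_≡_; refl; sym; trans; cong; cong₂; subst)

module _ (P : ℕ → Set) where

  Minimal : ℕ → Set
  Minimal r = P r × (∀ r' → P r' → r ≤ r')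

  private
    search : (∀ k → Dec (P k)) → ∀ k → ∃ Minimal ⊎ (∀ r → P r → k ≤ r)
    search P? zero = inj₂ (λ _ _ → z≤n)
    search P? (suc k) with search P? k
    ... | inj₁ least = inj₁ least
    ... | inj₂ k≤ with P? k
    ...   | yes Pk = inj₁ (k , Pk , k≤)
    ...   | no ¬Pk = inj₂ (λ r Pr → ≤∧≢⇒< (k≤ r Pr) (λ { refl → ¬Pk Pr }))

  least-witness : (∀ k → Dec (P k)) → ∀ k → P k → ∃ Minimal
  least-witness P? k Pk with search P? (suc k)
  ... | inj₁ least  = least
  ... | inj₂ suc-k≤ = contradiction (suc-k≤ k Pk) 1+n≰n

∨-introˡ : ∀ {a} b → a ≡ true → a ∨ b ≡ true
∨-introˡ b refl = refl

∨-introʳ : ∀ a {b} → b ≡ true → a ∨ b ≡ true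
∨-introʳ true  _ = refl
∨-introʳ false p = p

∨-elim : ∀ a {b} → a ∨ b ≡ true → a ≡ true ⊎ b ≡ true
∨-elim true  _ = inj₁ refl
∨-elim false p = inj₂ p

∧-monoʳ : ∀ a {b c} → (b ≡ true → c ≡ true) → a ∧ b ≡ true → a ∧ c ≡ true
∧-monoʳ true b⇒c = b⇒c

≤ᵇ-monoʳ : ∀ k {m n} → m ≤ n → (k ≤ᵇ m) ≡ true → (k ≤ᵇ n) ≡ true
≤ᵇ-monoʳ k {m} m≤n k≤ᵇm =
  Equivalence.to T-≡ (≤⇒≤ᵇ (≤-trans (≤ᵇ⇒≤ k m (Equivalence.from T-≡ k≤ᵇm)) m≤n))

indicator : Bool → ℕ
indicator b = if b then 1 else 0

indicator-mono : ∀ {a b} → (a ≡ true → b ≡ true) → indicator a ≤ indicator b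
indicator-mono {false}         _   = z≤n
indicator-mono {true}  {true}  _   = ≤-refl
indicator-mono {true}  {false} a⇒b = contradiction (a⇒b refl) λ ()

indicator-∨ : ∀ a b → indicator (a ∨ b) ≤ indicator a + indicator b
indicator-∨ true  _ = s≤s z≤n
indicator-∨ false _ = ≤-refl

_⊆_ : ∀ {A : Set} → (A → Bool) → (A → Bool) → Set
f ⊆ g = ∀ i → f i ≡ true → g i ≡ true

enumerate : ∀ {k} → (Fin k → Bool) → List (Fin k)
enumerate {zero}  f = []
enumerate {suc k} f =
  if f fzero then fzero ∷ map fsuc (enumerate (f ∘ fsuc)) else map fsuc (enumerate (f ∘ fsuc))

∈-enumerate : ∀ {k} (f : Fin k → Bool) {v} → f v ≡ true → v ∈ enumerate f
∈-enumerate {suc k} f {v} fv with f fzero in f0 | v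
... | true  | fzero  = here refl
... | false | fzero  = contradiction (trans (sym fv) f0) λ ()
... | true  | fsuc u = there (∈-map⁺ fsuc (∈-enumerate (f ∘ fsuc) fv))
... | false | fsuc u = ∈-map⁺ fsuc (∈-enumerate (f ∘ fsuc) fv)

module _ (G : Graph) where
  open Graph G using (n; Adj)

  count-mono : ∀ {k} {f g : Fin k → Bool} → f ⊆ g → count G f ≤ count G g
  count-mono {zero}  f⊆g = z≤n
  count-mono {suc k} f⊆g = +-mono-≤ (indicator-mono (f⊆g fzero)) (count-mono (f⊆g ∘ fsuc))

  count-cong : ∀ {k} {f g : Fin k → Bool} → (∀ i → f i ≡ g i) → count G f ≡ count G g
  count-cong {zero}  f≗g = refl
  count-cong {suc k} f≗g = cong₂ _+_ (cong indicator (f≗g fzero)) (count-cong (f≗g ∘ fsuc))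

  count-∨ : ∀ {k} (f g : Fin k → Bool) → count G (λ i → f i ∨ g i) ≤ count G f + count G g
  count-∨ {zero}  f g = z≤n
  count-∨ {suc k} f g = begin
    indicator (f fzero ∨ g fzero) + count G (λ i → f (fsuc i) ∨ g (fsuc i))
      ≤⟨ +-mono-≤ (indicator-∨ (f fzero) (g fzero)) (count-∨ (f ∘ fsuc) (g ∘ fsuc)) ⟩
    (indicator (f fzero) + indicator (g fzero)) + (count G (f ∘ fsuc) + count G (g ∘ fsuc))
      ≡⟨ interchange +-commutativeSemigroup
           (indicator (f fzero)) (indicator (g fzero)) (count G (f ∘ fsuc)) (count G (g ∘ fsuc)) ⟩
    (indicator (f fzero) + count G (f ∘ fsuc)) + (indicator (g fzero) + count G (g ∘ fsuc)) ∎
    where open ≤-Reasoning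

  count-false : ∀ {k} → count G {k} (λ _ → false) ≡ 0
  count-false {zero}  = refl
  count-false {suc k} = count-false {k}

  count-singleton : ∀ {k} (x : Fin k) → count G (λ i → ⌊ x ≟ i ⌋) ≡ 1
  count-singleton {suc k} fzero    = cong suc (count-false {k})
  count-singleton {suc k} (fsuc x) =
    trans (count-cong (λ i → ⌊⌋-map′ _ _ (x ≟ i))) (count-singleton x)

  length-enumerate : ∀ {k} (f : Fin k → Bool) → length (enumerate f) ≡ count G f
  length-enumerate {zero}  f = refl
  length-enumerate {suc k} f with f fzero
  ... | true  = cong suc (trans (length-map fsuc (enumerate (f ∘ fsuc))) (length-enumerate (f ∘ fsuc)))
  ... | false = trans (length-map fsuc (enumerate (f ∘ fsuc))) (length-enumerate (f ∘ fsuc))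

  sourceSet : List (Fin n) → VSet G
  sourceSet s v = any (λ x → ⌊ x ≟ v ⌋) s

  card-sourceSet≤length : ∀ s → card G (sourceSet s) ≤ length s
  card-sourceSet≤length []       = ≤-reflexive (count-false {n})
  card-sourceSet≤length (x ∷ xs) = begin
    card G (sourceSet (x ∷ xs))
      ≤⟨ count-∨ (λ v → ⌊ x ≟ v ⌋) (sourceSet xs) ⟩
    count G (λ v → ⌊ x ≟ v ⌋) + card G (sourceSet xs)
      ≤⟨ +-mono-≤ (≤-reflexive (count-singleton x)) (card-sourceSet≤length xs) ⟩
    suc (length xs) ∎
    where open ≤-Reasoning

  twoNbrs-mono : ∀ {B C} → B ⊆ C → twoNbrs G B ⊆ twoNbrs G C
  twoNbrs-mono B⊆C v = ≤ᵇ-monoʳ 2 (count-mono (λ u → ∧-monoʳ (Adj v u) (B⊆C u)))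

  twoNbrs-cong : ∀ {B C} → (∀ u → B u ≡ C u) → ∀ v → twoNbrs G B v ≡ twoNbrs G C v
  twoNbrs-cong B≗C v = cong (2 ≤ᵇ_) (count-cong (λ u → cong (Adj v u ∧_) (B≗C u)))

  allBlue? : ∀ B → Dec (AllBlue G B)
  allBlue? B = all? (λ v → B v ≟ᵇ true)

  blueAt-inflationary : ∀ A t → A ⊆ blueAt G A t
  blueAt-inflationary A zero    v Av = Av
  blueAt-inflationary A (suc t) v Av = ∨-introˡ _ (blueAt-inflationary A t v Av)

  burnAt-mono : ∀ s {j j'} → j ≤ j' → burnAt G s j ⊆ burnAt G s j'
  burnAt-mono s j≤j' = go (≤⇒≤′ j≤j')
    where
    go : ∀ {j j'} → j ≤′ j' → burnAt G s j ⊆ burnAt G s j'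
    go ≤′-refl       v p = p
    go (≤′-step j≤j') v p = ∨-introˡ _ (go j≤j' v p)

  srcAt⊆burnAt : ∀ s j → srcAt G s j ⊆ burnAt G s (suc j)
  srcAt⊆burnAt s j v p = ∨-introʳ (burnAt G s j v) (∨-introˡ _ p)

  srcAt⊆sourceSet : ∀ s j → srcAt G s j ⊆ sourceSet s
  srcAt⊆sourceSet (x ∷ xs) zero    v p = ∨-introˡ _ p
  srcAt⊆sourceSet (x ∷ xs) (suc j) v p = ∨-introʳ ⌊ x ≟ v ⌋ (srcAt⊆sourceSet xs j v p)

  ∈⇒srcAt : ∀ {x} s → x ∈ s → ∃ λ j → j < length s × srcAt G s j x ≡ true
  ∈⇒srcAt (x ∷ xs) (here refl) = zero , s≤s z≤n , trans (isYes≗does (x ≟ x)) (dec-true (x ≟ x) refl)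
  ∈⇒srcAt (y ∷ xs) (there x∈xs) with ∈⇒srcAt xs x∈xs
  ... | j , j<len , src = suc j , s≤s j<len , src

  burnAt⊆blueAt : ∀ s j → burnAt G s j ⊆ blueAt G (sourceSet s) j
  burnAt⊆blueAt s (suc j) v burnt with ∨-elim (burnAt G s j v) burnt
  ... | inj₁ old = ∨-introˡ _ (burnAt⊆blueAt s j v old)
  ... | inj₂ new with ∨-elim (srcAt G s j v) new
  ...   | inj₁ src = ∨-introˡ _ (blueAt-inflationary (sourceSet s) j v (srcAt⊆sourceSet s j v src))
  ...   | inj₂ two = ∨-introʳ (blueAt G (sourceSet s) j v) (twoNbrs-mono (burnAt⊆blueAt s j) v two)

  sourceSet-percolates : ∀ s r → AllBlue G (burnAt G s r) → Percolating G (sourceSet s)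
  sourceSet-percolates s r all = r , λ v → burnAt⊆blueAt s r v (all v)

  srcAt-take : ∀ {k j} s → j < k → ∀ v → srcAt G (take k s) j v ≡ srcAt G s j v
  srcAt-take {suc k}         []      _         v = refl
  srcAt-take {suc k} {zero}  (x ∷ s) _         v = refl
  srcAt-take {suc k} {suc j} (x ∷ s) (s≤s j<k) v = srcAt-take s j<k v

  burnAt-take : ∀ {k j} s → j ≤ k → ∀ v → burnAt G (take k s) j v ≡ burnAt G s j v
  burnAt-take {j = zero}  s _   v = refl
  burnAt-take {j = suc j} s j<k v =
    cong₂ _∨_ (burnAt-take s (<⇒≤ j<k) v)
              (cong₂ _∨_ (srcAt-take s j<k v) (twoNbrs-cong (burnAt-take s (<⇒≤ j<k)) v))

  Rd-take : ∀ {s r} → Rd G s r → Rd G (take r s) r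
  Rd-take {s} {r} (all , least) = (λ v → trans (burnAt-take s (≤-refl {r}) v) (all v)) , least′
    where
    least′ : ∀ r' → AllBlue G (burnAt G (take r s) r') → r ≤ r'
    least′ r' all′ with ≤-total r' r
    ... | inj₁ r'≤r = least r' (λ v → trans (sym (burnAt-take s r'≤r v)) (all′ v))
    ... | inj₂ r≤r' = r≤r'

  A⊆burnAt-enumerate : ∀ A → A ⊆ burnAt G (enumerate A) (card G A)
  A⊆burnAt-enumerate A v Av with ∈⇒srcAt (enumerate A) (∈-enumerate A Av)
  ... | j , j<len , src =
    burnAt-mono (enumerate A) (subst (suc j ≤_) (length-enumerate A) j<len) v (srcAt⊆burnAt _ j v src)

  blueAt⊆burnAt-enumerate : ∀ A t → blueAt G A t ⊆ burnAt G (enumerate A) (t + card G A)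
  blueAt⊆burnAt-enumerate A zero    = A⊆burnAt-enumerate A
  blueAt⊆burnAt-enumerate A (suc t) v blue with ∨-elim (blueAt G A t v) blue
  ... | inj₁ old = ∨-introˡ _ (blueAt⊆burnAt-enumerate A t v old)
  ... | inj₂ two = ∨-introʳ (burnAt G (enumerate A) (t + card G A) v)
                     (∨-introʳ (srcAt G (enumerate A) (t + card G A) v)
                       (twoNbrs-mono (blueAt⊆burnAt-enumerate A t) v two))

  Rd-enumerate : ∀ A t → AllBlue G (blueAt G A t) → ∃ λ r → r ≤ card G A + t × Rd G (enumerate A) r
  Rd-enumerate A t all =
    let r , rd = least-witness (AllBlue G ∘ burnAt G (enumerate A)) (allBlue? ∘ burnAt G (enumerate A))
                               (card G A + t) burnt
    in r , proj₂ rd _ burnt , rd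
    where
    burnt : AllBlue G (burnAt G (enumerate A) (card G A + t))
    burnt v = subst (λ r → burnAt G (enumerate A) r v ≡ true) (+-comm t (card G A))
                (blueAt⊆burnAt-enumerate A t v (all v))

mainTheorem18 : (G : Graph) → Connected G →
    (m τ b t : ℕ) → IsM2 G m → IsTau2 G m τ → IsB2 G b → IsT2 G b t →
    (m ≤ t) × (t ≤ b) × (b ≤ m + τ)
mainTheorem18 G _ m τ b t (_ , m≤card) ((A , |A|≡m , (Aτ , _)) , _) (_ , b≤rd) ((s , rd , |s|≡t) , t≤length) =
  m≤t , t≤b , b≤m+τ
  where
  open ≤-Reasoning

  m≤t : m ≤ t
  m≤t = begin
    m                      ≤⟨ m≤card (sourceSet G s) (sourceSet-percolates G s b (proj₁ rd)) ⟩
    card G (sourceSet G s) ≤⟨ card-sourceSet≤length G s ⟩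
    length s               ≡⟨ |s|≡t ⟩
    t                      ∎

  t≤b : t ≤ b
  t≤b = begin
    t                 ≤⟨ t≤length (take b s) (Rd-take G rd) ⟩
    length (take b s) ≡⟨ length-take b s ⟩
    b ⊓ length s      ≤⟨ m⊓n≤m b (length s) ⟩
    b                 ∎

  b≤m+τ : b ≤ m + τ
  b≤m+τ with Rd-enumerate G A τ Aτ
  ... | r , r≤|A|+τ , rdA = begin
    b            ≤⟨ b≤rd (enumerate A) r rdA ⟩
    r            ≤⟨ r≤|A|+τ ⟩
    card G A + τ ≡⟨ cong (_+ τ) |A|≡m ⟩
    m + τ        ∎
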